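{- Every $\alpha$-valuation of a complete bipartite graph $K_{a,b}$ can be obtained from the trivial $\alpha$-valuation $(\{0\},\{1\})$ of $K_{1,1}$ by an alternating sequence of Blowup I and Blowup II operations.
   Context: An $\alpha$-valuation of $K_{a,b}$ is a one-to-one labelling of its vertices by elements of $\{0,1,\dots,ab\}$ such that the absolute differences of endpoint labels over all edges are exactly $\{1,\dots,ab\}$, and there is a value $x$ such that every edge joins a vertex with label $\le x$ to a vertex with label $>x$. Vertices are identified with labels, and the valuation is recorded as the pair $(V^{\sf small},V^{\sf large})$ of the sets of labels $\le x$ and $>x$ respectively. For an integer $\ell>1$: the Blowup I operation with parameter $\ell$ sends $(W^{\sf small},W^{\sf large})$ to $(\{\ell i+j: i\in W^{\sf small},\,0\le j\le \ell-1\},\ \{\ell y: y\in W^{\sf large}\})$ (an $\alpha$-valuation of $K_{\ell a,b}$ when the input is one of $K_{a,b}$ with $|W^{\sf small}|=a$); the Blowup II operation with parameter $\ell$ sends $(W^{\sf small},W^{\sf large})$ to $(\{\ell i: i\in W^{\sf small}\},\ \{\ell y-j: y\in W^{\sf large},\,0\le j\le \ell-1\})$ (an $\alpha$-valuation of $K_{a,\ell b}$). An alternating sequence is one in which consecutive operations are of different types (each with its own parameter $\ell$). -}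

module Defs where

open import Data.Nat using (ℕ; zero; suc; _+_; _*_; _∸_; _≤_; _<_; ∣_-_∣)
open import Data.List using (List; []; _∷_; length; map; concatMap; upTo)
open import Data.List.Membership.Propositional using (_∈_)
open import Data.List.Relation.Unary.Unique.Propositional using (Unique)
open import Data.List.Relation.Unary.All using (All)
open import Data.Product using (Σ; _×_; _,_; ∃; ∃-syntax)
open import Data.Empty using (⊥)
open import Data.Unit using (⊤)
open import Relation.Nullary using (¬_)
open import Relation.Binary.PropositionalEquality using (_≡_; _≢_)
open import Function.Bundles using (_⇔_)

-- A labelling of K_{a,b} is recorded as the pair (Vsmall , Vlarge) of label
-- lists; a = length Vsmall, b = length Vlarge.  Labels are distinct (Unique
-- on each side, and the two sides are disjoint), so lists stand for sets.
record IsAlphaValuation (a b : ℕ) (Vsmall Vlarge : List ℕ) : Set where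
  field
    small-size  : length Vsmall ≡ a
    large-size  : length Vlarge ≡ b
    small-uniq  : Unique Vsmall
    large-uniq  : Unique Vlarge
    disjoint    : ∀ v → v ∈ Vsmall → v ∈ Vlarge → ⊥
    small-range : All (λ v → v ≤ a * b) Vsmall
    large-range : All (λ v → v ≤ a * b) Vlarge
    differences : ∀ d → (1 ≤ d × d ≤ a * b) ⇔
                        (∃[ u ] ∃[ v ] (u ∈ Vsmall × v ∈ Vlarge × ∣ u - v ∣ ≡ d))
    threshold   : ∃[ x ] (All (λ v → v ≤ x) Vsmall × All (λ v → x < v) Vlarge)

data BlowupType : Set where
  I II : BlowupType

record Op : Set where
  constructor op
  field
    kind  : BlowupType
    param : ℕ
    param>1 : 1 < param

Valuation : Set
Valuation = List ℕ × List ℕ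

blowupI : ℕ → Valuation → Valuation
blowupI ℓ (S , L) = concatMap (λ i → map (λ j → ℓ * i + j) (upTo ℓ)) S , map (ℓ *_) L

blowupII : ℕ → Valuation → Valuation
blowupII ℓ (S , L) = map (ℓ *_) S , concatMap (λ y → map (λ j → ℓ * y ∸ j) (upTo ℓ)) L

applyOp : Op → Valuation → Valuation
applyOp (op I ℓ _)  = blowupI ℓ
applyOp (op II ℓ _) = blowupII ℓ

applyOps : List Op → Valuation → Valuation
applyOps []         W = W
applyOps (o ∷ os)   W = applyOps os (applyOp o W)

Alternating : List Op → Set
Alternating []               = ⊤
Alternating (o ∷ [])         = ⊤
Alternating (o ∷ o′ ∷ os)    = (Op.kind o ≢ Op.kind o′) × Alternating (o′ ∷ os)

trivial : Valuation
trivial = (0 ∷ []) , (1 ∷ [])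

SameSets : Valuation → Valuation → Set
SameSets (S , L) (S′ , L′) = (∀ v → v ∈ S ⇔ v ∈ S′) × (∀ v → v ∈ L ⇔ v ∈ L′)

-- An α-valuation (S, L) of K_{a,b} with N = ab is the same thing as a tiling
-- S ⊕ (N − L) = {0, …, N − 1}: every m < N is s + b for exactly one pair with
-- s ∈ S and N − b ∈ L, because the edge lengths v − u run through 1, …, N once
-- each.  Let P ⊕ Q = {0, …, N − 1} be a tiling with 1 ∈ P and let k be the least
-- number outside P.  Then every element of Q is a multiple of k, P is a union of
-- blocks {kq, …, kq + k − 1}, and k divides N; so P ⊕ Q is Blowup I (parameter k)
-- of the tiling {q | kq ∈ P} ⊕ {c | kc ∈ Q} of {0, …, N/k − 1}.  Symmetrically,
-- if 1 ∈ Q it is a Blowup II.  Induction on N produces the sequence, and it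
-- alternates: k ∉ P means 1 ∉ {q | kq ∈ P}, so the smaller tiling came from a
-- blowup of the other type.
module Submission where

open import Defs
open import Data.Nat using (ℕ; _≤_)
open import Data.List using (List)
open import Data.Product using (Σ; _×_; _,_; ∃; ∃-syntax)

open import Data.Nat
  using (zero; suc; _+_; _*_; _∸_; _<_; ∣_-_∣; z≤n; s≤s; z<s; s<s; _/_; _%_; >-nonZero)
open import Data.Nat.Properties
open import Data.Nat.DivMod using (m≡m%n+[m/n]*n; m%n<n)
open import Data.Nat.Induction using (<-rec)
open import Data.Nat.Solver using (module +-*-Solver)
open import Data.Product using (∃₂; proj₁; proj₂)
open import Data.Sum using (_⊎_; inj₁; inj₂)
open import Data.Empty using (⊥)
open import Data.Unit using (tt)
open import Data.Fin using (Fin; toℕ; combine; punchOut)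
open import Data.Fin.Properties
  using (any?; injective⇒≤; punchOut-injective; combine-injective; toℕ-injective; toℕ<n)
  renaming (_≟_ to _≟ᶠ_)
open import Data.List
  using ([]; _∷_; length; map; concatMap; upTo; _++_; _∷ʳ_; cartesianProductWith)
open import Data.List.Relation.Unary.Any using (here; index) renaming (any? to anyᴸ?)
open import Data.List.Relation.Unary.All using () renaming (lookup to lookupᴬ)
open import Data.List.Membership.Propositional using (_∈_; find; lose)
open import Data.List.Membership.Propositional.Properties
  using (∈-map⁺; ∈-map⁻; ∈-upTo⁺; ∈-upTo⁻; ∈-cartesianProductWith⁺; ∈-cartesianProductWith⁻)
open import Data.List.Membership.DecPropositional _≟_ using (_∈?_)
open import Data.List.Membership.Setoid.Properties using (index-injective)
open import Function using (_∘_)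
open import Function.Bundles using (_⇔_; mk⇔; Equivalence)
open import Function.Definitions using (Injective)
import Function.Properties.Equivalence as ⇔
open import Relation.Binary.Definitions using (tri<; tri≈; tri>)
open import Relation.Binary.PropositionalEquality
open import Relation.Nullary using (¬_; yes; no; contradiction)
open import Relation.Nullary.Decidable using (map′)
open import Relation.Unary using (Decidable)

open +-*-Solver using (solve; _:+_; _:*_; _:=_; con)

divMod : ∀ {k} → 0 < k → ∀ m → ∃₂ λ q r → r < k × m ≡ k * q + r
divMod {k@(suc _)} _ m = m / k , m % k , m%n<n m k , (begin
  m                    ≡⟨ m≡m%n+[m/n]*n m k ⟩
  m % k + m / k * k    ≡⟨ +-comm (m % k) _ ⟩
  m / k * k + m % k    ≡⟨ cong (_+ m % k) (*-comm (m / k) k) ⟩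
  k * (m / k) + m % k  ∎)
  where open ≡-Reasoning

k*q+r<k*q′ : ∀ {k q q′ r} → r < k → q < q′ → k * q + r < k * q′
k*q+r<k*q′ {k} {q} {q′} {r} r<k q<q′ = begin-strict
  k * q + r  <⟨ +-monoʳ-< (k * q) r<k ⟩
  k * q + k  ≡⟨ +-comm (k * q) k ⟩
  k + k * q  ≡⟨ *-suc k q ⟨
  k * suc q  ≤⟨ *-monoʳ-≤ k q<q′ ⟩
  k * q′     ∎
  where open ≤-Reasoning

divMod-unique : ∀ {k q q′ r r′} → r < k → r′ < k → k * q + r ≡ k * q′ + r′ → q ≡ q′ × r ≡ r′
divMod-unique {k} {q} {q′} {r} {r′} r<k r′<k eq with <-cmp q q′
... | tri< q<q′ _ _ = contradiction eq (<⇒≢ (<-≤-trans (k*q+r<k*q′ r<k q<q′) (m≤m+n _ r′)))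
... | tri≈ _ refl _ = refl , +-cancelˡ-≡ (k * q) r r′ eq
... | tri> _ _ q′<q = contradiction (sym eq) (<⇒≢ (<-≤-trans (k*q+r<k*q′ r′<k q′<q) (m≤m+n _ r)))

0<k*[1+c] : ∀ {k c} → 0 < k → 0 < k * suc c
0<k*[1+c] {k} {c} 0<k = <-≤-trans 0<k (m≤m*n k (suc c))

k*[p+c]+r≡k*p+r+k*c : ∀ k p c r → k * (p + c) + r ≡ (k * p + r) + k * c
k*[p+c]+r≡k*p+r+k*c = solve 4 (λ k p c r → k :* (p :+ c) :+ r := (k :* p :+ r) :+ k :* c) refl

divMod-+-multiple : ∀ {k s c q r} → 0 < k → r < k → s + k * c ≡ k * q + r →
                    ∃ λ p → s ≡ k * p + r × p + c ≡ q
divMod-+-multiple {k} {s} {c} {q} {r} 0<k r<k eq with divMod 0<k s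
... | p , r₀ , r₀<k , s≡ with divMod-unique r₀<k r<k (begin
  k * (p + c) + r₀    ≡⟨ k*[p+c]+r≡k*p+r+k*c k p c r₀ ⟩
  (k * p + r₀) + k * c ≡⟨ cong (_+ k * c) s≡ ⟨
  s + k * c           ≡⟨ eq ⟩
  k * q + r           ∎)
  where open ≡-Reasoning
... | p+c≡q , refl = p , s≡ , p+c≡q

-- Tilings of an initial segment

record Tiling (N : ℕ) (P Q : ℕ → Set) : Set where
  field
    bounded : ∀ {s b} → P s → Q b → s + b < N
    covers  : ∀ {m} → m < N → ∃₂ λ s b → P s × Q b × s + b ≡ m
    unique  : ∀ {s b s′ b′} → P s → Q b → P s′ → Q b′ → s + b ≡ s′ + b′ → s ≡ s′

swap : ∀ {N P Q} → Tiling N P Q → Tiling N Q P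
swap {N} {P} {Q} T = record
  { bounded = λ {b} {s} b∈Q s∈P → subst (_< N) (+-comm s b) (bounded s∈P b∈Q)
  ; covers  = λ m<N → let s , b , s∈P , b∈Q , s+b≡m = covers m<N
                      in b , s , b∈Q , s∈P , trans (+-comm b s) s+b≡m
  ; unique  = λ {b} {s} {b′} {s′} b∈Q s∈P b′∈Q s′∈P b+s≡b′+s′ →
      let s≡s′ = unique s∈P b∈Q s′∈P b′∈Q (trans (+-comm s b) (trans b+s≡b′+s′ (+-comm b′ s′)))
      in +-cancelʳ-≡ s b b′ (trans b+s≡b′+s′ (cong (b′ +_) (sym s≡s′)))
  }
  where open Tiling T

module TilingProperties {N P Q} (T : Tiling N P Q) (0<N : 0 < N) where
  open Tiling T

  0∈P : P 0
  0∈P = let s , _ , s∈P , _ , s+b≡0 = covers 0<N in subst P (m+n≡0⇒m≡0 s s+b≡0) s∈P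

  0∈Q : Q 0
  0∈Q = let s , _ , _ , b∈Q , s+b≡0 = covers 0<N in subst Q (m+n≡0⇒n≡0 s s+b≡0) b∈Q

  P<N : ∀ {s} → P s → s < N
  P<N {s} s∈P = subst (_< N) (+-identityʳ s) (bounded s∈P 0∈Q)

  Q<N : ∀ {b} → Q b → b < N
  Q<N b∈Q = bounded 0∈P b∈Q

  sum∉P : ∀ {s b} → P s → Q b → 0 < b → ¬ P (s + b)
  sum∉P {s} {b} s∈P b∈Q 0<b s+b∈P = <⇒≢ 0<b (sym (+-cancelˡ-≡ s b 0 s+b≡s+0))
    where
    s+b≡s+0 : s + b ≡ s + 0
    s+b≡s+0 = trans (unique s+b∈P 0∈Q s∈P b∈Q (+-identityʳ _)) (sym (+-identityʳ s))

  sum∉Q : ∀ {s b} → P s → Q b → 0 < s → ¬ Q (s + b)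
  sum∉Q s∈P b∈Q 0<s s+b∈Q = <⇒≢ 0<s (unique 0∈P s+b∈Q s∈P b∈Q refl)

-- The structure of a tiling

AllMultiplesOf : ℕ → (ℕ → Set) → Set
AllMultiplesOf k Q = ∀ {b} → Q b → ∃ λ c → b ≡ k * c

UnionOfBlocks : ℕ → (ℕ → Set) → Set
UnionOfBlocks k P = ∀ q {r} → r < k → P (k * q + r) ⇔ P (k * q)

module Structure {N P Q} (T : Tiling N P Q) (0<N : 0 < N) {k} (0<k : 0 < k)
                 (below-k : ∀ {j} → j < k → P j) (k∉P : ¬ P k) where
  open Tiling T
  open TilingProperties T 0<N

  Q-below-k : ∀ {m} → Q m → m < k → m ≡ 0
  Q-below-k {m} m∈Q m<k = unique (below-k m<k) 0∈Q 0∈P m∈Q (+-comm m 0)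

  k∈Q : k < N → Q k
  k∈Q k<N with covers k<N
  ... | s , b , s∈P , b∈Q , s+b≡k with m≤n⇒m<n∨m≡n (subst (b ≤_) s+b≡k (m≤n+m b s))
  ...   | inj₂ refl = b∈Q
  ...   | inj₁ b<k with Q-below-k b∈Q b<k
  ...     | refl = contradiction (subst P (trans (sym (+-identityʳ s)) s+b≡k) s∈P) k∉P

  record Claims (m : ℕ) : Set where
    field
      multiple : Q m → ∃ λ c → m ≡ k * c
      down     : ∀ {q r} → r < k → m ≡ k * q + r → P m → P (k * q)
      up       : ∀ {q r} → r < k → m ≡ k * q + r → P (k * q) → P m

  module Step {m} (ih : ∀ {y} → y < m → Claims y) where

    -- kq is split by the tiling as kp + kc; if c ≠ 0, then m = (kp + r) + kc splits properly.
    split-of-lower-multiple : ∀ {q r} → 0 < r → r < k → m ≡ k * q + r → k * q < N →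
                     P (k * q) ⊎ (¬ P m × ¬ Q m)
    split-of-lower-multiple {q} {r} 0<r r<k m≡ kq<N with covers kq<N
    ... | s , b , s∈P , b∈Q , s+b≡kq with Claims.multiple (ih b<m) b∈Q
      where
      b<m : b < m
      b<m = ≤-<-trans (subst (b ≤_) s+b≡kq (m≤n+m b s))
                      (subst (k * q <_) (sym m≡) (m<m+n (k * q) 0<r))
    ... | zero , refl =
          inj₁ (subst P (trans (sym (+-identityʳ s)) (trans (cong (s +_) (sym (*-zeroʳ k))) s+b≡kq)) s∈P)
    ... | suc c , refl
          with p , s≡ , p+c≡q ← divMod-+-multiple 0<k 0<k (trans s+b≡kq (sym (+-identityʳ _))) =
          inj₂ (subst (¬_ ∘ P) m≡split (sum∉P kp+r∈P b∈Q (0<k*[1+c] 0<k)) ,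
                subst (¬_ ∘ Q) m≡split (sum∉Q kp+r∈P b∈Q (<-≤-trans 0<r (m≤n+m r (k * p)))))
      where
      m≡split : (k * p + r) + k * suc c ≡ m
      m≡split = trans (sym (k*[p+c]+r≡k*p+r+k*c k p (suc c) r)) (trans (cong (λ x → k * x + r) p+c≡q) (sym m≡))
      kp+r<m : k * p + r < m
      kp+r<m = subst (k * p + r <_) m≡split (m<m+n _ (0<k*[1+c] 0<k))
      kp+r∈P : P (k * p + r)
      kp+r∈P = Claims.up (ih kp+r<m) r<k refl (subst P (trans s≡ (+-identityʳ _)) s∈P)

    multiple : Q m → ∃ λ c → m ≡ k * c
    multiple m∈Q with divMod 0<k m
    ... | q , zero , _ , m≡ = q , trans m≡ (+-identityʳ _)
    ... | zero , suc r , r<k , m≡ = contradiction (trans (sym (Q-below-k m∈Q (subst (_< k) (sym m≡r) r<k))) m≡r) 0≢1+n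
      where
      m≡r : m ≡ suc r
      m≡r = trans m≡ (cong (_+ suc r) (*-zeroʳ k))
    ... | suc q , suc r , r<k , m≡ with split-of-lower-multiple z<s r<k m≡ kq<N
      where
      kq<N : k * suc q < N
      kq<N = <-trans (subst (k * suc q <_) (sym m≡) (m<m+n _ z<s)) (Q<N m∈Q)
    ...   | inj₂ (_ , m∉Q) = contradiction m∈Q m∉Q
    ...   | inj₁ kq∈P = contradiction k∸r≡kq (<⇒≢ (<-≤-trans (∸-monoʳ-< z<s (<⇒≤ r<k)) (m≤m*n k (suc q))))
      where
      -- (k − r) + m = kq + k is a second split of the same number.
      k∸r≡kq : k ∸ suc r ≡ k * suc q
      k∸r≡kq = unique (below-k (∸-monoʳ-< z<s (<⇒≤ r<k))) m∈Q kq∈P (k∈Q (≤-<-trans (m≤m*n k (suc q)) (P<N kq∈P)))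
        (begin
          k ∸ suc r + m                   ≡⟨ cong (k ∸ suc r +_) m≡ ⟩
          k ∸ suc r + (k * suc q + suc r) ≡⟨ +-comm (k ∸ suc r) _ ⟩
          k * suc q + suc r + (k ∸ suc r) ≡⟨ +-assoc (k * suc q) _ _ ⟩
          k * suc q + (suc r + (k ∸ suc r)) ≡⟨ cong (k * suc q +_) (m+[n∸m]≡n (<⇒≤ r<k)) ⟩
          k * suc q + k                   ∎)
        where open ≡-Reasoning

    down : ∀ {q r} → r < k → m ≡ k * q + r → P m → P (k * q)
    down {r = zero} _ m≡ m∈P = subst P (trans m≡ (+-identityʳ _)) m∈P
    down {q} {suc r} r<k m≡ m∈P with split-of-lower-multiple z<s r<k m≡ kq<N
      where
      kq<N : k * q < N
      kq<N = <-trans (subst (k * q <_) (sym m≡) (m<m+n _ z<s)) (P<N m∈P)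
    ... | inj₁ kq∈P = kq∈P
    ... | inj₂ (m∉P , _) = contradiction m∈P m∉P

    up : ∀ {q r} → r < k → m ≡ k * q + r → P (k * q) → P m
    up {r = zero} _ m≡ kq∈P = subst P (sym (trans m≡ (+-identityʳ _))) kq∈P
    up {zero} {suc r} r<k m≡ _ = below-k (subst (_< k) (sym (trans m≡ (cong (_+ suc r) (*-zeroʳ k)))) r<k)
    up {suc q} {suc r} r<k m≡ kq∈P with covers m<N
      where
      m<N : m < N
      m<N = subst (_< N) (sym m≡) (<-trans (+-monoʳ-< (k * suc q) r<k)
              (bounded kq∈P (k∈Q (≤-<-trans (m≤m*n k (suc q)) (P<N kq∈P)))))
    ... | s , b , s∈P , b∈Q , s+b≡m with m≤n⇒m<n∨m≡n (subst (b ≤_) s+b≡m (m≤n+m b s))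
    ...   | inj₂ refl with c , m≡kc ← multiple b∈Q
      = contradiction (proj₂ (divMod-unique 0<k r<k (trans (+-identityʳ _) (trans (sym m≡kc) m≡)))) 0≢1+n
    ...   | inj₁ b<m with Claims.multiple (ih b<m) b∈Q
    ...     | zero , refl = subst P (trans (sym (trans (cong (s +_) (*-zeroʳ k)) (+-identityʳ s))) s+b≡m) s∈P
    ...     | suc c , refl
              with p , s≡ , p+c≡q ← divMod-+-multiple 0<k r<k (trans s+b≡m m≡) =
              contradiction kq∈P (subst (¬_ ∘ P) kp+kc≡kq (sum∉P kp∈P b∈Q (0<k*[1+c] 0<k)))
      where
      kp∈P : P (k * p)
      kp∈P = Claims.down (ih (subst (s <_) s+b≡m (m<m+n s (0<k*[1+c] 0<k)))) r<k s≡ s∈P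
      kp+kc≡kq : k * p + k * suc c ≡ k * suc q
      kp+kc≡kq = trans (sym (*-distribˡ-+ k p (suc c))) (cong (k *_) p+c≡q)

  claims : ∀ m → Claims m
  claims = <-rec Claims λ m ih → record
    { multiple = Step.multiple ih ; down = Step.down ih ; up = Step.up ih }

  Q-multiples : AllMultiplesOf k Q
  Q-multiples {b} = Claims.multiple (claims b)

  P-blocks : UnionOfBlocks k P
  P-blocks q r<k = mk⇔ (Claims.down (claims _) r<k refl) (Claims.up (claims _) r<k refl)

-- N − 1 = (kp + j) + kc; the block of kp cannot extend past N − 1, so j = k − 1.
divides-length : ∀ {N P Q k} → Tiling N P Q → 0 < N → 0 < k →
               UnionOfBlocks k P → AllMultiplesOf k Q → ∃ λ N′ → N ≡ k * N′
divides-length {suc M} {P} {k = k} T _ 0<k P-blocks Q-multiples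
  with s , b , s∈P , b∈Q , s+b≡M ← Tiling.covers T (n<1+n M)
  with c , refl ← Q-multiples b∈Q
  with p , j , j<k , refl ← divMod 0<k s
  with m≤n⇒m<n∨m≡n j<k
... | inj₁ 1+j<k = contradiction (Tiling.bounded T next∈P b∈Q) (<-irrefl next+b≡N)
  where
  next∈P : P (k * p + suc j)
  next∈P = Equivalence.from (P-blocks p 1+j<k) (Equivalence.to (P-blocks p j<k) s∈P)
  next+b≡N : k * p + suc j + k * c ≡ suc M
  next+b≡N = trans (cong (_+ k * c) (+-suc (k * p) j)) (cong suc s+b≡M)
... | inj₂ refl = p + 1 + c , (begin
  suc M                    ≡⟨ cong suc s+b≡M ⟨
  suc (k * p + j + k * c)  ≡⟨ cong (_+ k * c) (+-suc (k * p) j) ⟨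
  k * p + k + k * c        ≡⟨ solve 3 (λ k p c → k :* p :+ k :+ k :* c := k :* (p :+ con 1 :+ c)) refl k p c ⟩
  k * (p + 1 + c)          ∎)
  where open ≡-Reasoning

contract : ∀ {N P Q k N′} → Tiling N P Q → 0 < k → AllMultiplesOf k Q →
         N ≡ k * N′ → Tiling N′ (P ∘ (k *_)) (Q ∘ (k *_))
contract {N} {P} {Q} {k} {N′} T 0<k Q-multiples N≡kN′ = record
  { bounded = λ {q} {c} kq∈P kc∈Q →
      *-cancelˡ-< k (q + c) N′ (subst₂ _<_ (sym (*-distribˡ-+ k q c)) N≡kN′ (bounded kq∈P kc∈Q))
  ; covers  = covers-scaled
  ; unique  = λ {q} {c} {q′} {c′} kq∈P kc∈Q kq′∈P kc′∈Q q+c≡q′+c′ → *-cancelˡ-≡ q q′ k {{>-nonZero 0<k}}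
      (unique kq∈P kc∈Q kq′∈P kc′∈Q (begin
        k * q + k * c   ≡⟨ *-distribˡ-+ k q c ⟨
        k * (q + c)     ≡⟨ cong (k *_) q+c≡q′+c′ ⟩
        k * (q′ + c′)   ≡⟨ *-distribˡ-+ k q′ c′ ⟩
        k * q′ + k * c′ ∎))
  }
  where
  open Tiling T
  open ≡-Reasoning
  covers-scaled : ∀ {m} → m < N′ → ∃₂ λ q c → P (k * q) × Q (k * c) × q + c ≡ m
  covers-scaled {m} m<N′
    with s , b , s∈P , b∈Q , s+b≡km ← covers (subst (k * m <_) (sym N≡kN′) (*-monoʳ-< k {{>-nonZero 0<k}} m<N′))
    with c , refl ← Q-multiples b∈Q
    with p , s≡ , p+c≡m ← divMod-+-multiple 0<k 0<k (trans s+b≡km (sym (+-identityʳ _)))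
    = p , c , subst P (trans s≡ (+-identityʳ _)) s∈P , b∈Q , p+c≡m

-- Blowups of represented valuations

Mirror : ℕ → (ℕ → Set) → ℕ → Set
Mirror N Q v = ∃ λ b → Q b × b + v ≡ N

-- A valuation (S , L) represents the tiling P ⊕ Q of {0, …, N − 1} when S = P and L = N − Q.
Represents : ℕ → (ℕ → Set) → (ℕ → Set) → Valuation → Set
Represents N P Q (S , L) = (∀ x → x ∈ S ⇔ P x) × (∀ v → v ∈ L ⇔ Mirror N Q v)

concatMap-map≡cartesianProductWith : (f : ℕ → ℕ → ℕ) (xs ys : List ℕ) →
                                     concatMap (λ x → map (f x) ys) xs ≡ cartesianProductWith f xs ys
concatMap-map≡cartesianProductWith f []       ys = refl
concatMap-map≡cartesianProductWith f (x ∷ xs) ys =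
  cong (map (f x) ys ++_) (concatMap-map≡cartesianProductWith f xs ys)

∈-concatMap-upTo⁺ : ∀ (f : ℕ → ℕ → ℕ) {ℓ xs i j} → i ∈ xs → j < ℓ →
                    f i j ∈ concatMap (λ i → map (f i) (upTo ℓ)) xs
∈-concatMap-upTo⁺ f {ℓ} {xs} i∈xs j<ℓ =
  subst (_ ∈_) (sym (concatMap-map≡cartesianProductWith f xs (upTo ℓ)))
        (∈-cartesianProductWith⁺ f i∈xs (∈-upTo⁺ j<ℓ))

∈-concatMap-upTo⁻ : ∀ (f : ℕ → ℕ → ℕ) {ℓ xs x} → x ∈ concatMap (λ i → map (f i) (upTo ℓ)) xs →
                    ∃₂ λ i j → i ∈ xs × j < ℓ × x ≡ f i j
∈-concatMap-upTo⁻ f {ℓ} {xs} x∈ with i , j , i∈xs , j∈upTo , x≡ ←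
  ∈-cartesianProductWith⁻ f xs (upTo ℓ) (subst (_ ∈_) (concatMap-map≡cartesianProductWith f xs (upTo ℓ)) x∈)
  = i , j , i∈xs , ∈-upTo⁻ j∈upTo , x≡

∈-map-*⇔ : ∀ {k X xs} → AllMultiplesOf k X → (∀ y → y ∈ xs ⇔ X (k * y)) →
           ∀ x → x ∈ map (k *_) xs ⇔ X x
∈-map-*⇔ {k} {X} {xs} X-multiples xs≈ _ = mk⇔ to from
  where
  to : ∀ {x} → x ∈ map (k *_) xs → X x
  to x∈ with y , y∈xs , refl ← ∈-map⁻ (k *_) x∈ = Equivalence.to (xs≈ y) y∈xs
  from : ∀ {x} → X x → x ∈ map (k *_) xs
  from x∈X with y , refl ← X-multiples x∈X = ∈-map⁺ (k *_) (Equivalence.from (xs≈ y) x∈X)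

∈-blocks⇔ : ∀ {k P xs} → 0 < k → UnionOfBlocks k P → (∀ q → q ∈ xs ⇔ P (k * q)) →
            ∀ x → x ∈ concatMap (λ i → map (λ j → k * i + j) (upTo k)) xs ⇔ P x
∈-blocks⇔ {k} {P} {xs} 0<k P-blocks xs≈ _ = mk⇔ to from
  where
  to : ∀ {x} → x ∈ concatMap (λ i → map (λ j → k * i + j) (upTo k)) xs → P x
  to x∈ with q , r , q∈xs , r<k , refl ← ∈-concatMap-upTo⁻ (λ i j → k * i + j) {k} {xs} x∈ =
    Equivalence.from (P-blocks q r<k) (Equivalence.to (xs≈ q) q∈xs)
  from : ∀ {x} → P x → x ∈ concatMap (λ i → map (λ j → k * i + j) (upTo k)) xs
  from {x} x∈P with q , r , r<k , refl ← divMod 0<k x =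
    ∈-concatMap-upTo⁺ (λ i j → k * i + j) {k} {xs} (Equivalence.from (xs≈ q) (Equivalence.to (P-blocks q r<k) x∈P)) r<k

module _ {N k N′ : ℕ} {P Q : ℕ → Set} (0<k : 0 < k) (N≡kN′ : N ≡ k * N′) where

  mirror-multiples : AllMultiplesOf k Q → AllMultiplesOf k (Mirror N Q)
  mirror-multiples Q-multiples (b , b∈Q , b+v≡N) with c , refl ← Q-multiples b∈Q
    with y , v≡ , _ ← divMod-+-multiple 0<k 0<k (trans (+-comm _ (k * c)) (trans b+v≡N (trans N≡kN′ (sym (+-identityʳ _)))))
    = y , trans v≡ (+-identityʳ _)

  mirror-scaled⇔ : AllMultiplesOf k Q → ∀ y → Mirror N′ (Q ∘ (k *_)) y ⇔ Mirror N Q (k * y)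
  mirror-scaled⇔ Q-multiples y = mk⇔ to from
    where
    to : Mirror N′ (Q ∘ (k *_)) y → Mirror N Q (k * y)
    to (c , kc∈Q , c+y≡N′) = k * c , kc∈Q , trans (sym (*-distribˡ-+ k c y)) (trans (cong (k *_) c+y≡N′) (sym N≡kN′))
    from : Mirror N Q (k * y) → Mirror N′ (Q ∘ (k *_)) y
    from (b , b∈Q , b+ky≡N) with c , refl ← Q-multiples b∈Q =
      c , b∈Q , *-cancelˡ-≡ (c + y) N′ k {{>-nonZero 0<k}} (trans (*-distribˡ-+ k c y) (trans b+ky≡N N≡kN′))

  blowupI-represents : UnionOfBlocks k P → AllMultiplesOf k Q →
                       ∀ W → Represents N′ (P ∘ (k *_)) (Q ∘ (k *_)) W → Represents N P Q (blowupI k W)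
  blowupI-represents P-blocks Q-multiples _ (S≈ , L≈) =
    ∈-blocks⇔ 0<k P-blocks S≈ ,
    ∈-map-*⇔ {k} (mirror-multiples Q-multiples) (λ y → ⇔.trans (L≈ y) (mirror-scaled⇔ Q-multiples y))

  -- The blocks of Q reappear in L = N − Q as the blocks {ky − k + 1, …, ky}.
  ∈-downBlocks⇔ : UnionOfBlocks k Q → (∀ {b} → Q b → b < N) → ∀ {L} →
                  (∀ y → y ∈ L ⇔ Mirror N′ (Q ∘ (k *_)) y) →
                  ∀ v → v ∈ concatMap (λ y → map (λ j → k * y ∸ j) (upTo k)) L ⇔ Mirror N Q v
  ∈-downBlocks⇔ Q-blocks Q<N {L} L≈ _ = mk⇔ to from
    where
    kc<kN′ : ∀ {c} → Q (k * c) → k * c < k * N′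
    kc<kN′ kc∈Q = subst (_ <_) N≡kN′ (Q<N kc∈Q)

    to : ∀ {v} → v ∈ concatMap (λ y → map (λ j → k * y ∸ j) (upTo k)) L → Mirror N Q v
    to v∈ with y , j , y∈L , j<k , refl ← ∈-concatMap-upTo⁻ (λ y j → k * y ∸ j) {k} {L} v∈
      with c , kc∈Q , c+y≡N′ ← Equivalence.to (L≈ y) y∈L
      = k * c + j , Equivalence.from (Q-blocks c j<k) kc∈Q , (begin
        k * c + j + (k * y ∸ j)   ≡⟨ +-assoc (k * c) j _ ⟩
        k * c + (j + (k * y ∸ j)) ≡⟨ cong (k * c +_) (m+[n∸m]≡n j≤ky) ⟩
        k * c + k * y             ≡⟨ *-distribˡ-+ k c y ⟨
        k * (c + y)               ≡⟨ cong (k *_) c+y≡N′ ⟩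
        k * N′                    ≡⟨ N≡kN′ ⟨
        N                         ∎)
      where
      open ≡-Reasoning
      c<N′ : c < N′
      c<N′ = *-cancelˡ-< k c N′ (kc<kN′ kc∈Q)
      0<y : 0 < y
      0<y = +-cancelˡ-< c 0 y (subst₂ _<_ (sym (+-identityʳ c)) (sym c+y≡N′) c<N′)
      j≤ky : j ≤ k * y
      j≤ky = ≤-trans (<⇒≤ j<k) (m≤m*n k y {{>-nonZero 0<y}})

    from : ∀ {v} → Mirror N Q v → v ∈ concatMap (λ y → map (λ j → k * y ∸ j) (upTo k)) L
    from {v} (b , b∈Q , b+v≡N) with c , j , j<k , refl ← divMod 0<k b =
      subst (_∈ _) v≡ky∸j (∈-concatMap-upTo⁺ (λ y j → k * y ∸ j) {k} {L} (Equivalence.from (L≈ (N′ ∸ c)) y∈Mirror) j<k)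
      where
      kc∈Q : Q (k * c)
      kc∈Q = Equivalence.to (Q-blocks c j<k) b∈Q
      c+y≡N′ : c + (N′ ∸ c) ≡ N′
      c+y≡N′ = m+[n∸m]≡n (<⇒≤ (*-cancelˡ-< k c N′ (kc<kN′ kc∈Q)))
      y∈Mirror : Mirror N′ (Q ∘ (k *_)) (N′ ∸ c)
      y∈Mirror = c , kc∈Q , c+y≡N′
      j+v≡ky : j + v ≡ k * (N′ ∸ c)
      j+v≡ky = +-cancelˡ-≡ (k * c) _ _ (begin
        k * c + (j + v)          ≡⟨ +-assoc (k * c) j v ⟨
        k * c + j + v            ≡⟨ b+v≡N ⟩
        N                        ≡⟨ N≡kN′ ⟩
        k * N′                   ≡⟨ cong (k *_) c+y≡N′ ⟨
        k * (c + (N′ ∸ c))       ≡⟨ *-distribˡ-+ k c _ ⟩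
        k * c + k * (N′ ∸ c)     ∎)
        where open ≡-Reasoning
      v≡ky∸j : k * (N′ ∸ c) ∸ j ≡ v
      v≡ky∸j = trans (cong (_∸ j) (sym j+v≡ky)) (m+n∸m≡n j v)

  blowupII-represents : AllMultiplesOf k P → UnionOfBlocks k Q → (∀ {b} → Q b → b < N) →
                        ∀ W → Represents N′ (P ∘ (k *_)) (Q ∘ (k *_)) W → Represents N P Q (blowupII k W)
  blowupII-represents P-multiples Q-blocks Q<N _ (S≈ , L≈) =
    ∈-map-*⇔ {k} P-multiples S≈ , ∈-downBlocks⇔ Q-blocks Q<N L≈

EndsWith : BlowupType → List Op → Set
EndsWith t []           = ⊥
EndsWith t (o ∷ [])     = Op.kind o ≡ t
EndsWith t (_ ∷ o ∷ os) = EndsWith t (o ∷ os)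

alternating-∷ʳ : ∀ ops o → Alternating ops → ¬ EndsWith (Op.kind o) ops → Alternating (ops ∷ʳ o)
alternating-∷ʳ []            _ _              _      = tt
alternating-∷ʳ (_ ∷ [])      _ _              ¬ends  = ¬ends , tt
alternating-∷ʳ (_ ∷ o′ ∷ os) o (kinds≢ , alt) ¬ends = kinds≢ , alternating-∷ʳ (o′ ∷ os) o alt ¬ends

endsWith-∷ʳ : ∀ ops o {t} → EndsWith t (ops ∷ʳ o) → Op.kind o ≡ t
endsWith-∷ʳ []            _ ends = ends
endsWith-∷ʳ (_ ∷ [])      _ ends = ends
endsWith-∷ʳ (_ ∷ o′ ∷ os) o ends = endsWith-∷ʳ (o′ ∷ os) o ends

applyOps-∷ʳ : ∀ ops o W → applyOps (ops ∷ʳ o) W ≡ applyOp o (applyOps ops W)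
applyOps-∷ʳ []       _ _ = refl
applyOps-∷ʳ (o′ ∷ os) o W = applyOps-∷ʳ os o (applyOp o′ W)

OneIn : BlowupType → (ℕ → Set) → (ℕ → Set) → Set
OneIn I  P _ = P 1
OneIn II _ Q = Q 1

-- After a blowup of type t, 1 lies on side t; this is what keeps the sequence alternating.
record Generated (N : ℕ) (P Q : ℕ → Set) : Set where
  field
    ops         : List Op
    alternating : Alternating ops
    represents  : Represents N P Q (applyOps ops trivial)
    last-kind   : ∀ {t} → EndsWith t ops → OneIn t P Q

generated-trivial : ∀ {P Q} → Tiling 1 P Q → Generated 1 P Q
generated-trivial {P} {Q} T = record
  { ops         = []
  ; alternating = tt
  ; represents  = (λ _ → mk⇔ to₀ from₀) , (λ _ → mk⇔ to₁ from₁)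
  ; last-kind   = λ ()
  }
  where
  open TilingProperties T z<s
  to₀ : ∀ {x} → x ∈ 0 ∷ [] → P x
  to₀ (here refl) = 0∈P
  from₀ : ∀ {x} → P x → x ∈ 0 ∷ []
  from₀ x∈P with P<N x∈P
  ... | s≤s z≤n = here refl
  to₁ : ∀ {v} → v ∈ 1 ∷ [] → Mirror 1 Q v
  to₁ (here refl) = 0 , 0∈Q , refl
  from₁ : ∀ {v} → Mirror 1 Q v → v ∈ 1 ∷ []
  from₁ (b , b∈Q , b+v≡1) with Q<N b∈Q
  ... | s≤s z≤n = here b+v≡1

extend : ∀ {N P Q N′ P′ Q′} (o : Op) → Generated N′ P′ Q′ →
         ¬ OneIn (Op.kind o) P′ Q′ → OneIn (Op.kind o) P Q →
         (∀ W → Represents N′ P′ Q′ W → Represents N P Q (applyOp o W)) → Generated N P Q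
extend {N} {P} {Q} o g fresh one lift = record
  { ops         = ops ∷ʳ o
  ; alternating = alternating-∷ʳ ops o alternating (fresh ∘ last-kind)
  ; represents  = subst (Represents N P Q) (sym (applyOps-∷ʳ ops o trivial)) (lift _ represents)
  ; last-kind   = λ ends → subst (λ t → OneIn t P Q) (endsWith-∷ʳ ops o ends) one
  }
  where open Generated g

-- Every tiling is generated

all-below⊎least-absent : ∀ {P : ℕ → Set} → Decidable P → ∀ n →
                         (∀ {j} → j < n → P j) ⊎ ∃ λ k → ¬ P k × (∀ {j} → j < k → P j)
all-below⊎least-absent P? zero = inj₁ λ ()
all-below⊎least-absent {P} P? (suc n) with all-below⊎least-absent P? n
... | inj₂ found = inj₂ found
... | inj₁ below with P? n
...   | no n∉P = inj₂ (n , n∉P , below)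
...   | yes n∈P = inj₁ below-suc
  where
  below-suc : ∀ {j} → j < suc n → P j
  below-suc j<1+n with m<1+n⇒m<n∨m≡n j<1+n
  ... | inj₁ j<n = below j<n
  ... | inj₂ refl = n∈P

least-absent : ∀ {P : ℕ → Set} → Decidable P → ∀ {n} → ¬ P n → ∃ λ k → ¬ P k × (∀ {j} → j < k → P j)
least-absent P? {n} n∉P with all-below⊎least-absent P? (suc n)
... | inj₁ below = contradiction (below (n<1+n n)) n∉P
... | inj₂ found = found

1<absent : ∀ {P : ℕ → Set} {k} → P 0 → P 1 → ¬ P k → 1 < k
1<absent {k = zero}        0∈P _   k∉P = contradiction 0∈P k∉P
1<absent {k = suc zero}    _   1∈P k∉P = contradiction 1∈P k∉P
1<absent {k = suc (suc _)} _   _   _   = s<s z<s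

1∈P⊎1∈Q : ∀ {N P Q} → Tiling N P Q → 1 < N → P 1 ⊎ Q 1
1∈P⊎1∈Q T 1<N with Tiling.covers T 1<N
... | zero        , _ , _   , b∈Q , refl = inj₂ b∈Q
... | suc zero    , _ , s∈P , _   , _    = inj₁ s∈P
... | suc (suc _) , _ , _   , _   , ()

quotient-bounds : ∀ {k N N′} → 1 < k → 0 < N → N ≡ k * N′ → 0 < N′ × N′ < N
quotient-bounds {k} {N′ = zero}  _   0<N N≡k*0 = contradiction (sym (trans N≡k*0 (*-zeroʳ k))) (<⇒≢ 0<N)
quotient-bounds {k} {N′ = suc n} 1<k _   refl  = z<s , subst (suc n <_) (*-comm (suc n) k) (m<m*n (suc n) k 1<k)

record BlowupDecomposition (t : BlowupType) (N : ℕ) (P Q : ℕ → Set) : Set where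
  field
    k        : ℕ
    1<k      : 1 < k
    N′       : ℕ
    N≡kN′    : N ≡ k * N′
    quotient : Tiling N′ (P ∘ (k *_)) (Q ∘ (k *_))
    fresh    : ¬ OneIn t (P ∘ (k *_)) (Q ∘ (k *_))
    lift     : ∀ W → Represents N′ (P ∘ (k *_)) (Q ∘ (k *_)) W →
               Represents N P Q (applyOp (op t k 1<k) W)

decomposeI : ∀ {N P Q} → Tiling N P Q → 0 < N → Decidable P → P 1 → BlowupDecomposition I N P Q
decomposeI {N} {P} {Q} T 0<N P? 1∈P
  with k , k∉P , below-k ← least-absent P? (<-irrefl refl ∘ TilingProperties.P<N T 0<N) = record
  { k        = k
  ; 1<k      = 1<k
  ; N′       = proj₁ k∣N
  ; N≡kN′    = proj₂ k∣N
  ; quotient = contract T 0<k Q-multiples (proj₂ k∣N)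
  ; fresh    = k∉P ∘ subst P (*-identityʳ k)
  ; lift     = blowupI-represents 0<k (proj₂ k∣N) P-blocks Q-multiples
  }
  where
  1<k : 1 < k
  1<k = 1<absent {P} (TilingProperties.0∈P T 0<N) 1∈P k∉P
  0<k : 0 < k
  0<k = <-trans z<s 1<k
  open Structure T 0<N 0<k below-k k∉P
  k∣N : ∃ λ N′ → N ≡ k * N′
  k∣N = divides-length T 0<N 0<k P-blocks Q-multiples

decomposeII : ∀ {N P Q} → Tiling N P Q → 0 < N → Decidable Q → Q 1 → BlowupDecomposition II N P Q
decomposeII {N} {P} {Q} T 0<N Q? 1∈Q
  with k , k∉Q , below-k ← least-absent Q? (<-irrefl refl ∘ TilingProperties.Q<N T 0<N) = record
  { k        = k
  ; 1<k      = 1<k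
  ; N′       = proj₁ k∣N
  ; N≡kN′    = proj₂ k∣N
  ; quotient = swap (contract (swap T) 0<k P-multiples (proj₂ k∣N))
  ; fresh    = k∉Q ∘ subst Q (*-identityʳ k)
  ; lift     = blowupII-represents 0<k (proj₂ k∣N) P-multiples Q-blocks (TilingProperties.Q<N T 0<N)
  }
  where
  1<k : 1 < k
  1<k = 1<absent {Q} (TilingProperties.0∈Q T 0<N) 1∈Q k∉Q
  0<k : 0 < k
  0<k = <-trans z<s 1<k
  open Structure (swap T) 0<N 0<k below-k k∉Q
    renaming (Q-multiples to P-multiples; P-blocks to Q-blocks)
  k∣N : ∃ λ N′ → N ≡ k * N′
  k∣N = divides-length (swap T) 0<N 0<k Q-blocks P-multiples

Generatable : ℕ → Set₁
Generatable N = ∀ {P Q : ℕ → Set} → 0 < N → Decidable P → Decidable Q → Tiling N P Q → Generated N P Q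

generated-by-decomposition : ∀ {t N P Q} → (∀ {N′} → N′ < N → Generatable N′) → 0 < N →
                             Decidable P → Decidable Q → BlowupDecomposition t N P Q → OneIn t P Q →
                             Generated N P Q
generated-by-decomposition {t} ih 0<N P? Q? d one =
  extend (op t k 1<k) (ih N′<N 0<N′ (P? ∘ (k *_)) (Q? ∘ (k *_)) quotient) fresh one lift
  where
  open BlowupDecomposition d
  0<N′ : 0 < N′
  0<N′ = proj₁ (quotient-bounds 1<k 0<N N≡kN′)
  N′<N : N′ < _
  N′<N = proj₂ (quotient-bounds 1<k 0<N N≡kN′)

generate : ∀ N → Generatable N
generate = <-rec Generatable step
  where
  step : ∀ N → (∀ {N′} → N′ < N → Generatable N′) → Generatable N
  step (suc zero)      _  _   _  _  T = generated-trivial T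
  step (suc (suc _))   ih 0<N P? Q? T with 1∈P⊎1∈Q T (s<s z<s)
  ... | inj₁ 1∈P = generated-by-decomposition ih 0<N P? Q? (decomposeI T 0<N P? 1∈P) 1∈P
  ... | inj₂ 1∈Q = generated-by-decomposition ih 0<N P? Q? (decomposeII T 0<N Q? 1∈Q) 1∈Q

-- α-valuations are tilings

injective⇒surjective : ∀ {n} {f : Fin n → Fin n} → Injective _≡_ _≡_ f → ∀ y → ∃ λ x → f x ≡ y
injective⇒surjective {suc n} {f} f-injective y with any? (λ x → f x ≟ᶠ y)
... | yes hit  = hit
... | no  miss = contradiction (injective⇒≤ punched-injective) 1+n≰n
  where
  punched : Fin (suc n) → Fin n
  punched x = punchOut (λ y≡fx → miss (x , sym y≡fx))
  punched-injective : Injective _≡_ _≡_ punched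
  punched-injective {x} {x′} eq =
    f-injective (punchOut-injective (λ y≡fx → miss (x , sym y≡fx)) (λ y≡fx′ → miss (x′ , sym y≡fx′)) eq)

mirror? : ∀ N (xs : List ℕ) → Decidable (Mirror N (_∈ xs))
mirror? N xs b = map′ find (λ (v , v∈xs , v+b≡N) → lose v∈xs v+b≡N) (anyᴸ? (λ v → v + b ≟ N) xs)

mirror-mirror⇔ : ∀ {N X} → (∀ {v} → X v → v ≤ N) → ∀ v → Mirror N (Mirror N X) v ⇔ X v
mirror-mirror⇔ {N} {X} X≤N v = mk⇔ to from
  where
  to : Mirror N (Mirror N X) v → X v
  to (b , (v′ , v′∈X , v′+b≡N) , b+v≡N) =
    subst X (+-cancelˡ-≡ b v′ v (trans (+-comm b v′) (trans v′+b≡N (sym b+v≡N)))) v′∈X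
  from : X v → Mirror N (Mirror N X) v
  from v∈X = N ∸ v , (v , v∈X , m+[n∸m]≡n (X≤N v∈X)) , m∸n+n≡m (X≤N v∈X)

module _ {S L : List ℕ} (V : IsAlphaValuation (length S) (length L) S L) where
  open IsAlphaValuation V

  private
    N : ℕ
    N = length S * length L

  small<large : ∀ {u v} → u ∈ S → v ∈ L → u < v
  small<large u∈S v∈L = let _ , S≤x , x<L = threshold in ≤-<-trans (lookupᴬ S≤x u∈S) (lookupᴬ x<L v∈L)

  record Edge (d : ℕ) : Set where
    field
      small   : ℕ
      large   : ℕ
      small∈S : small ∈ S
      large∈L : large ∈ L
      length≡ : ∣ small - large ∣ ≡ d

  edge : (e : Fin N) → Edge (suc (toℕ e))
  edge e with u , v , u∈S , v∈L , d≡ ← Equivalence.to (differences (suc (toℕ e))) (s≤s z≤n , toℕ<n e)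
    = record { small∈S = u∈S ; large∈L = v∈L ; length≡ = d≡ }

  position : Fin N → Fin N
  position e = combine (index (Edge.small∈S (edge e))) (index (Edge.large∈L (edge e)))

  same-position : ∀ e {u v} (u∈S : u ∈ S) (v∈L : v ∈ L) → position e ≡ combine (index u∈S) (index v∈L) →
                  Edge.small (edge e) ≡ u × ∣ u - v ∣ ≡ suc (toℕ e)
  same-position e u∈S v∈L eq
    with i≡ , j≡ ← combine-injective _ _ _ _ eq
    with refl ← index-injective (setoid ℕ) _ u∈S i≡ | refl ← index-injective (setoid ℕ) _ v∈L j≡
    = refl , Edge.length≡ (edge e)

  position-injective : Injective _≡_ _≡_ position
  position-injective {e} {e′} eq =
    let _ , length≡e = same-position e (Edge.small∈S (edge e′)) (Edge.large∈L (edge e′)) eq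
    in toℕ-injective (suc-injective (trans (sym length≡e) (Edge.length≡ (edge e′))))

  -- |S| · |L| pairs realise |S| · |L| distinct lengths, so the length of a pair determines it.
  length-determines-small : ∀ {u v u′ v′} → u ∈ S → v ∈ L → u′ ∈ S → v′ ∈ L →
                            ∣ u - v ∣ ≡ ∣ u′ - v′ ∣ → u ≡ u′
  length-determines-small u∈S v∈L u′∈S v′∈L eq
    with e  , pos≡  ← injective⇒surjective position-injective (combine (index u∈S) (index v∈L))
       | e′ , pos′≡ ← injective⇒surjective position-injective (combine (index u′∈S) (index v′∈L))
    with small≡u , length≡e ← same-position e u∈S v∈L pos≡
       | small≡u′ , length≡e′ ← same-position e′ u′∈S v′∈L pos′≡
    with refl ← toℕ-injective (suc-injective (trans (sym length≡e) (trans eq length≡e′)))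
    = trans (sym small≡u) small≡u′

  length+sum≡N : ∀ {u v b} → u ∈ S → v ∈ L → v + b ≡ N → ∣ u - v ∣ + (u + b) ≡ N
  length+sum≡N {u} {v} {b} u∈S v∈L v+b≡N = begin
    ∣ u - v ∣ + (u + b)  ≡⟨ cong (_+ (u + b)) (m≤n⇒∣m-n∣≡n∸m u≤v) ⟩
    v ∸ u + (u + b)      ≡⟨ +-assoc (v ∸ u) u b ⟨
    v ∸ u + u + b        ≡⟨ cong (_+ b) (m∸n+n≡m u≤v) ⟩
    v + b                ≡⟨ v+b≡N ⟩
    N                    ∎
    where
    open ≡-Reasoning
    u≤v : u ≤ v
    u≤v = <⇒≤ (small<large u∈S v∈L)

  valuation-tiling : Tiling N (_∈ S) (Mirror N (_∈ L))
  valuation-tiling = record { bounded = bounded ; covers = covers ; unique = unique }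
    where
    open ≡-Reasoning
    bounded : ∀ {u b} → u ∈ S → Mirror N (_∈ L) b → u + b < N
    bounded {u} {b} u∈S (v , v∈L , v+b≡N) = subst (u + b <_) v+b≡N (+-monoˡ-< b (small<large u∈S v∈L))
    covers : ∀ {m} → m < N → ∃₂ λ u b → u ∈ S × Mirror N (_∈ L) b × u + b ≡ m
    covers {m} m<N
      with u , v , u∈S , v∈L , length≡N∸m ← Equivalence.to (differences (N ∸ m)) (m<n⇒0<n∸m m<N , m∸n≤m N m)
      = u , N ∸ v , u∈S , (v , v∈L , v+[N∸v]≡N) , +-cancelˡ-≡ (N ∸ m) _ _ (begin
        N ∸ m + (u + (N ∸ v))      ≡⟨ cong (_+ (u + (N ∸ v))) length≡N∸m ⟨
        ∣ u - v ∣ + (u + (N ∸ v))  ≡⟨ length+sum≡N u∈S v∈L v+[N∸v]≡N ⟩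
        N                          ≡⟨ m∸n+n≡m (<⇒≤ m<N) ⟨
        N ∸ m + m                  ∎)
      where
      v+[N∸v]≡N : v + (N ∸ v) ≡ N
      v+[N∸v]≡N = m+[n∸m]≡n (lookupᴬ large-range v∈L)
    unique : ∀ {u b u′ b′} → u ∈ S → Mirror N (_∈ L) b → u′ ∈ S → Mirror N (_∈ L) b′ →
             u + b ≡ u′ + b′ → u ≡ u′
    unique {u} {b} {u′} {b′} u∈S (v , v∈L , v+b≡N) u′∈S (v′ , v′∈L , v′+b′≡N) sum≡ =
      length-determines-small u∈S v∈L u′∈S v′∈L (+-cancelʳ-≡ (u + b) _ _ (begin
        ∣ u - v ∣ + (u + b)      ≡⟨ length+sum≡N u∈S v∈L v+b≡N ⟩
        N                        ≡⟨ length+sum≡N u′∈S v′∈L v′+b′≡N ⟨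
        ∣ u′ - v′ ∣ + (u′ + b′)  ≡⟨ cong (∣ u′ - v′ ∣ +_) sum≡ ⟨
        ∣ u′ - v′ ∣ + (u + b)    ∎))

theorem2p17 : (a b : ℕ) → 1 ≤ a → 1 ≤ b → (S L : List ℕ) → IsAlphaValuation a b S L →
    ∃[ ops ] (Alternating ops × SameSets (applyOps ops trivial) (S , L))
theorem2p17 a b 1≤a 1≤b S L V
  with refl ← IsAlphaValuation.small-size V
  with refl ← IsAlphaValuation.large-size V
  = ops , alternating , proj₁ represents ,
    λ v → ⇔.trans (proj₂ represents v) (mirror-mirror⇔ (lookupᴬ (IsAlphaValuation.large-range V)) v)
  where
  open Generated (generate (a * b) (*-mono-≤ 1≤a 1≤b) (_∈? S) (mirror? (a * b) L) (valuation-tiling V))
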